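{- Let $(f,C)$ be a low-defect pair of degree $k$ and let $a$ be the leading coefficient of $f$. Then $C\ge\|a\|+k$. Equivalently, if $f$ is a low-defect polynomial of degree $k$ with leading coefficient $a$, then $\|f\|\ge\|a\|+k$.
   Context: $\|n\|$ is the least number of $1$'s needed to write $n\in\mathbb{N}$ using $1$, $+$, $\times$, parentheses. Low-defect pairs form the smallest subset of $\mathbb{Z}[x_1,x_2,\ldots]\times\mathbb{N}$ such that: (i) $(k,C)$ is one for any constant $k\in\mathbb{N}$ and $C\ge\|k\|$; (ii) if $(f_1,C_1),(f_2,C_2)$ are ones, then so is $(f_1\otimes f_2,C_1+C_2)$, where $f_1\otimes f_2$ is the product after relabeling variables so they share none; (iii) if $(f,C)$ is one, $c\in\mathbb{N}$ and $D\ge\|c\|$, then $(f\cdot y+c,C+D)$ is one for a new variable $y$. The first coordinates are low-defect polynomials; a degree-$k$ one is multilinear in $k$ variables with nonzero leading coefficient (coefficient of the product of all variables). For a low-defect polynomial $f$, $\|f\|$ is the smallest $C$ such that $(f,C)$ is a low-defect pair. -}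

module Defs where

open import Data.Nat using (ℕ; zero; suc; _+_; _*_; _≤_)
open import Data.Bool using (Bool; true; false; if_then_else_; _∧_; not)
open import Data.Fin using (Fin; zero; suc; _↑ˡ_; _↑ʳ_)
open import Data.Product using (Σ; _×_; _,_)

-- Integer complexity.
-- `Cpx n m` : n can be written using 1, +, ×, parentheses with exactly
-- m ones.  (Only positive n are expressible.)

data Cpx : ℕ → ℕ → Set where
  one : Cpx 1 1
  add : ∀ {a b m n} → Cpx a m → Cpx b n → Cpx (a + b) (m + n)
  mul : ∀ {a b m n} → Cpx a m → Cpx b n → Cpx (a * b) (m + n)

IsComplexity : ℕ → ℕ → Set
IsComplexity n m = Cpx n m × (∀ m′ → Cpx n m′ → m ≤ m′)

-- ‖n‖ ≤ C  (unfolds to: some expression for n uses at most C ones)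
CpxLe : ℕ → ℕ → Set
CpxLe n C = Σ ℕ λ m → Cpx n m × m ≤ C

-- Multilinear polynomials in k variables x_0..x_{k-1}, given by their
-- coefficients: a monomial is a subset of the variables (Fin k → Bool).
-- Coefficients are natural numbers (all low-defect polynomials have
-- nonnegative integer coefficients).

Monomial : ℕ → Set
Monomial k = Fin k → Bool

Poly : ℕ → Set
Poly k = Monomial k → ℕ

isEmpty : ∀ {k} → Monomial k → Bool
isEmpty {zero}  S = true
isEmpty {suc k} S = not (S zero) ∧ isEmpty (λ i → S (suc i))

constP : ℕ → Poly 0
constP n S = n

-- f ⊗ g : product with variables of f and g disjoint
-- (f uses the first k₁ variables, g the last k₂).
_⊗_ : ∀ {k₁ k₂} → Poly k₁ → Poly k₂ → Poly (k₁ + k₂)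
_⊗_ {k₁} {k₂} f g S = f (λ i → S (i ↑ˡ k₂)) * g (λ j → S (k₁ ↑ʳ j))

-- f · y + c, with y the new variable (index zero).
extendP : ∀ {k} → Poly k → ℕ → Poly (suc k)
extendP f c S =
  if S zero then f (λ i → S (suc i))
  else (if isEmpty (λ i → S (suc i)) then c else 0)

leading : ∀ {k} → Poly k → ℕ
leading f = f (λ _ → true)

-- Low-defect pairs (f , C), with f a low-defect polynomial of degree k
-- (i.e. multilinear in exactly its k variables).

data LowDefect : (k : ℕ) → Poly k → ℕ → Set where
  const  : ∀ {n C} → CpxLe n C → LowDefect 0 (constP n) C
  tensor : ∀ {k₁ k₂ f₁ f₂ C₁ C₂} →
           LowDefect k₁ f₁ C₁ → LowDefect k₂ f₂ C₂ →
           LowDefect (k₁ + k₂) (f₁ ⊗ f₂) (C₁ + C₂)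
  extend : ∀ {k f C c D} → LowDefect k f C → CpxLe c D →
           LowDefect (suc k) (extendP f c) (C + D)

-- A constant k gives an expression for its leading
-- coefficient k with at most C ones; a product multiplies the two leading coefficients, so the
-- two expressions combine under × and the bounds add; f·y + c keeps the leading coefficient of f
-- while adding one variable and D ≥ ‖c‖ ≥ 1 to the cost.  Minimality of ‖a‖ finishes the proof.
module Submission where

open import Defs
open import Data.Nat using (ℕ; suc; _+_; _≤_; z≤n; s≤s)
open import Data.Nat.Properties
  using (≤-trans; m≤m+n; +-mono-≤; +-monoˡ-≤; +-suc; +-comm; +-identityʳ; +-commutativeSemigroup;
         module ≤-Reasoning)
open import Algebra.Properties.CommutativeSemigroup +-commutativeSemigroup using (interchange)
open import Data.Product using (Σ; _×_; _,_)
open import Relation.Binary.PropositionalEquality using (subst; sym)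

Cpx⇒1≤ : ∀ {n m} → Cpx n m → 1 ≤ m
Cpx⇒1≤ one                       = s≤s z≤n
Cpx⇒1≤ (add {m = m} {n = n} e _) = ≤-trans (Cpx⇒1≤ e) (m≤m+n m n)
Cpx⇒1≤ (mul {m = m} {n = n} e _) = ≤-trans (Cpx⇒1≤ e) (m≤m+n m n)

CpxLe⇒1≤ : ∀ {n C} → CpxLe n C → 1 ≤ C
CpxLe⇒1≤ (_ , e , m≤C) = ≤-trans (Cpx⇒1≤ e) m≤C

LeadingWithin : ∀ {k} → Poly k → ℕ → Set
LeadingWithin {k} f C = Σ ℕ λ m → Cpx (leading f) m × m + k ≤ C

lowDefect⇒leadingWithin : ∀ {k f C} → LowDefect k f C → LeadingWithin f C
lowDefect⇒leadingWithin {C = C} (const (m , e , m≤C)) =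
  m , e , subst (_≤ C) (sym (+-identityʳ m)) m≤C
lowDefect⇒leadingWithin (tensor {k₁} {k₂} {C₁ = C₁} {C₂} p₁ p₂)
  with lowDefect⇒leadingWithin p₁ | lowDefect⇒leadingWithin p₂
... | m₁ , e₁ , le₁ | m₂ , e₂ , le₂ =
  m₁ + m₂ , mul e₁ e₂ , subst (_≤ C₁ + C₂) (interchange m₁ k₁ m₂ k₂) (+-mono-≤ le₁ le₂)
lowDefect⇒leadingWithin (extend {k} {C = C} {D = D} p c≤D)
  with lowDefect⇒leadingWithin p
... | m , e , le = m , e , bound
  where
  open ≤-Reasoning
  bound : m + suc k ≤ C + D
  bound = begin
    m + suc k   ≡⟨ +-suc m k ⟩
    suc (m + k) ≡⟨ +-comm 1 (m + k) ⟩
    m + k + 1   ≤⟨ +-mono-≤ le (CpxLe⇒1≤ c≤D) ⟩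
    C + D       ∎

proposition3p24 : (k : ℕ) (f : Poly k) (C : ℕ) → LowDefect k f C →
    (m : ℕ) → IsComplexity (leading f) m → m + k ≤ C
proposition3p24 k f C p m (_ , m-minimal) with lowDefect⇒leadingWithin p
... | m′ , e , m′+k≤C = ≤-trans (+-monoˡ-≤ k (m-minimal m′ e)) m′+k≤C
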